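{- Let $p,q$ be coprime positive integers and let $Q_{p,q}$ be the complete bipartite quiver with vertex set $Q_L\sqcup Q_R$, $|Q_L|=p$, $|Q_R|=q$, with exactly one arrow from each vertex of $Q_L$ to each vertex of $Q_R$ and no other arrows. Then $P^{\Delta}(Q_{p,q},\delta_{Q_{p,q}})$ is $(\min\{p,q\}-1)$-neighborly.
   Context: For a quiver $Q=(Q_0,Q_1)$ (arrow $a$ with tail $a^-$, head $a^+$), $\mathrm{inc}:\mathbb{R}^{Q_1}\to\mathbb{R}^{Q_0}$, $\mathrm{inc}(f)_i=\sum_{a^+=i}f(a)-\sum_{a^-=i}f(a)$, and $\delta_Q=\mathrm{inc}(\mathbf{1})$. The flow polytope is $P(Q,\delta_Q)=\{x\in\mathbb{R}^{Q_1}:x\ge0,\ \mathrm{inc}(x)=\delta_Q\}$, and $P^{\Delta}(Q,\delta_Q)$ is the polar of $P(Q,\delta_Q)-\mathbf{1}$ within the linear space $\ker(\mathrm{inc})$: $\{c\in\ker(\mathrm{inc})^*: c(x)\le1\ \forall x\in P(Q,\delta_Q)-\mathbf{1}\}$. A polytope is $k$-neighborly if the convex hull of every $k$ of its vertices is a face.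
   Formalization: The flow polytope, its polar $P^{\Delta}(Q_{p,q},\delta_{Q_{p,q}})$, and the faces, vertices and convex hulls of the latter are taken over ℚ rather than ℝ, with faces exposed by rational functionals. -}

module Defs where

open import Level using (0ℓ)
open import Data.Nat as ℕ using (ℕ; zero; suc)
open import Data.Fin as Fin using (Fin; zero; suc; _↑ˡ_; _↑ʳ_; remQuot)
open import Data.Fin.Properties using (_≟_)
open import Data.Product using (Σ; ∃; _×_; _,_; proj₁; proj₂)
open import Data.Rational using (ℚ; 0ℚ; 1ℚ; _+_; _-_; _*_; _≤_)
open import Relation.Nullary.Decidable using (does)
open import Data.Bool using (if_then_else_)
open import Relation.Binary.PropositionalEquality using (_≡_)

record Quiver : Set where
  field
    nV    : ℕ
    nA    : ℕ
    tail  : Fin nA → Fin nV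
    head  : Fin nA → Fin nV
open Quiver public

Vecℚ : ℕ → Set
Vecℚ m = Fin m → ℚ

Σℚ : ∀ {m} → Vecℚ m → ℚ
Σℚ {zero}  f = 0ℚ
Σℚ {suc m} f = f zero + Σℚ {m} (λ i → f (suc i))

⟪_,_⟫ : ∀ {m} → Vecℚ m → Vecℚ m → ℚ
⟪ c , x ⟫ = Σℚ (λ a → c a * x a)

𝟏 : ∀ {m} → Vecℚ m
𝟏 _ = 1ℚ

_−ᵥ_ : ∀ {m} → Vecℚ m → Vecℚ m → Vecℚ m
(x −ᵥ y) a = x a - y a

inc : (Q : Quiver) → Vecℚ (nA Q) → Vecℚ (nV Q)
inc Q f i =
  Σℚ (λ a → if does (head Q a ≟ i) then f a else 0ℚ)
  - Σℚ (λ a → if does (tail Q a ≟ i) then f a else 0ℚ)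

δ : (Q : Quiver) → Vecℚ (nV Q)
δ Q = inc Q 𝟏

InFlowPolytope : (Q : Quiver) → Vecℚ (nA Q) → Set
InFlowPolytope Q x = (∀ a → 0ℚ ≤ x a) × (∀ i → inc Q x i ≡ δ Q i)

InKer : (Q : Quiver) → Vecℚ (nA Q) → Set
InKer Q x = ∀ i → inc Q x i ≡ 0ℚ

-- Elements of ker(inc)* are represented by c ∈ ℚ^{Q₁} acting by x ↦ ⟪c,x⟫;
-- two representatives define the same functional iff they agree on ker(inc).
Same : (Q : Quiver) → Vecℚ (nA Q) → Vecℚ (nA Q) → Set
Same Q c c' = ∀ x → InKer Q x → ⟪ c , x ⟫ ≡ ⟪ c' , x ⟫

InPolar : (Q : Quiver) → Vecℚ (nA Q) → Set
InPolar Q c = ∀ x → InFlowPolytope Q x → ⟪ c , x −ᵥ 𝟏 ⟫ ≤ 1ℚ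

IsFace : (Q : Quiver) → (Vecℚ (nA Q) → Set) → Set
IsFace Q F =
  (∀ c → F c → InPolar Q c) ×
  Σ (Vecℚ (nA Q)) λ x → Σ ℚ λ b →
    InKer Q x ×
    (∀ c → InPolar Q c → ⟪ c , x ⟫ ≤ b) ×
    (∀ c → F c → ⟪ c , x ⟫ ≡ b) ×
    (∀ c → InPolar Q c → ⟪ c , x ⟫ ≡ b → F c)

IsVertex : (Q : Quiver) → Vecℚ (nA Q) → Set
IsVertex Q v = IsFace Q (λ c → Same Q c v)

InConvHull : (Q : Quiver) → ∀ {k} → (Fin k → Vecℚ (nA Q)) → Vecℚ (nA Q) → Set
InConvHull Q {k} vs c =
  Σ (Vecℚ k) λ t →
    (∀ j → 0ℚ ≤ t j) × (Σℚ t ≡ 1ℚ) ×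
    Same Q c (λ a → Σℚ (λ j → t j * vs j a))

Neighborly : (Q : Quiver) → ℕ → Set
Neighborly Q k =
  (vs : Fin k → Vecℚ (nA Q)) →
  (∀ j → IsVertex Q (vs j)) →
  (∀ i j → Same Q (vs i) (vs j) → i ≡ j) →
  IsFace Q (InConvHull Q vs)

-- complete bipartite quiver Q_{p,q}: vertices Q_L = Fin p (first p), Q_R = Fin q,
-- arrows Fin (p*q) ≅ Fin p × Fin q, arrow (i,j) goes from L-vertex i to R-vertex j
Qbip : ℕ → ℕ → Quiver
Qbip p q = record
  { nV = p ℕ.+ q
  ; nA = p ℕ.* q
  ; tail = λ a → proj₁ (remQuot {p} q a) ↑ˡ q
  ; head = λ a → p ↑ʳ proj₂ (remQuot {p} q a)
  }

{-# OPTIONS --safe #-}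
-- Every vertex of P^Δ(Q_{p,q}) is −e_a for an arrow a: if x cuts out a vertex, −e_{a*} attains
-- the maximum of c ↦ ⟪c,x⟫ over P^Δ for any a* minimising x, because 𝟏 + x/max(−x) lies in the
-- flow polytope (if max(−x) ≤ 0 instead, then x ≥ 0, and x = 0 as kernel vectors have zero sum).
-- Given fewer than min(p,q) distinct vertices −e_a, a ∈ A, pick a row r₀ and a column c₀ that A
-- misses. The 4-cycles C_a = (e_{row a} − e_{r₀}) ⊗ (e_{col a} − e_{c₀}) lie in ker(inc) and are
-- dual to the coordinates on A, and a combination of them with 𝟏 is a flow y ∈ P vanishing exactly
-- on A; the inequalities this needs hold as soon as p ≠ q, which coprimality guarantees unless
-- min(p,q) = 1, where there is nothing to prove. The face cut out by y − 𝟏 is conv{−e_a : a ∈ A}: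
-- perturbing y inside P shows that a functional c on that face is determined by its values on the
-- C_a, so c = Σ_a (−⟪c,C_a⟫)(−e_a) with nonnegative coefficients summing to 1.
module Submission where

open import Defs

module Neighborliness where

  open import Data.Nat as ℕ using (ℕ; zero; suc)
  import Data.Nat.Properties as ℕP
  open import Data.Fin using (Fin; zero; suc; _↑ˡ_; _↑ʳ_; remQuot; combine; splitAt)
  open import Data.Fin.Properties
    using (_≟_; any?; ¬∀⟶∃¬; pigeonhole; <⇒≢; remQuot-combine; combine-remQuot; splitAt-↑ˡ; splitAt-↑ʳ)
  open import Data.Rational as ℚ using (ℚ; 0ℚ; 1ℚ; _+_; _-_; _*_; -_; 1/_; _≤_; _<_; ∣_∣)
  import Data.Rational.Properties as ℚP
  open import Data.Rational.Solver using (module +-*-Solver)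
  open +-*-Solver using (solve; _:=_; _:+_; _:*_; _:-_; :-_; con; Polynomial)
  open import Data.Bool using (true; false; if_then_else_)
  open import Data.Sum using (_⊎_; inj₁; inj₂; [_,_])
  open import Data.List using (allFin)
  import Data.List.Relation.Unary.All as All
  open import Data.List.Membership.Propositional.Properties using (∈-allFin)
  open import Relation.Binary.Bundles using (DecTotalOrder)
  open import Data.List.Extrema (DecTotalOrder.totalOrder ℚP.≤-decTotalOrder) using (argmax; f[xs]≤f[argmax])
  open import Data.Product using (∃; _×_; _,_; proj₁; proj₂)
  open import Algebra.Properties.Group ℚP.+-0-group using ()
    renaming (⁻¹-involutive to -‿involutive; x∙y⁻¹≈ε⇒x≈y to p-q≡0⇒p≡q)
  open import Function using (_∘_)
  open import Data.Empty using (⊥; ⊥-elim)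
  open import Relation.Nullary using (Dec; does; yes; no; ¬_; contradiction; _×-dec_)
  open import Relation.Binary.PropositionalEquality
    using (_≡_; _≢_; _≗_; refl; sym; trans; cong; cong₂; subst; subst₂; module ≡-Reasoning)

  fromℕ : ℕ → ℚ
  fromℕ zero    = 0ℚ
  fromℕ (suc n) = 1ℚ + fromℕ n

  fromℕ-+ : ∀ m n → fromℕ (m ℕ.+ n) ≡ fromℕ m + fromℕ n
  fromℕ-+ zero    n = sym (ℚP.+-identityˡ _)
  fromℕ-+ (suc m) n = trans (cong (1ℚ +_) (fromℕ-+ m n)) (sym (ℚP.+-assoc 1ℚ (fromℕ m) (fromℕ n)))

  p≤p+q : ∀ {p q} → 0ℚ ≤ q → p ≤ p + q
  p≤p+q {p} {q} 0≤q = begin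
    p       ≡⟨ sym (ℚP.+-identityʳ p) ⟩
    p + 0ℚ  ≤⟨ ℚP.+-monoʳ-≤ p 0≤q ⟩
    p + q   ∎
    where open ℚP.≤-Reasoning

  p≤q+p : ∀ {p q} → 0ℚ ≤ q → p ≤ q + p
  p≤q+p {p} {q} 0≤q = subst (_≤ q + p) (ℚP.+-identityˡ p) (ℚP.+-monoˡ-≤ p 0≤q)

  ≤⇒0≤- : ∀ {p q} → p ≤ q → 0ℚ ≤ q - p
  ≤⇒0≤- {p} {q} p≤q = subst (_≤ q - p) (ℚP.+-inverseʳ p) (ℚP.+-monoˡ-≤ (- p) p≤q)

  0≤+ : ∀ {p q} → 0ℚ ≤ p → 0ℚ ≤ q → 0ℚ ≤ p + q
  0≤+ 0≤p 0≤q = ℚP.≤-trans 0≤p (p≤p+q 0≤q)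

  0≤* : ∀ {p q} → 0ℚ ≤ p → 0ℚ ≤ q → 0ℚ ≤ p * q
  0≤* {p} {q} 0≤p 0≤q = ℚP.≤-trans (ℚP.≤-reflexive (sym (ℚP.*-zeroʳ p))) (ℚP.*-monoˡ-≤-nonNeg p {{ℚ.nonNegative 0≤p}} 0≤q)

  0≤1 : 0ℚ ≤ 1ℚ
  0≤1 = ℚP.<⇒≤ (ℚP.positive⁻¹ 1ℚ)

  fromℕ-nonneg : ∀ n → 0ℚ ≤ fromℕ n
  fromℕ-nonneg zero    = ℚP.≤-refl
  fromℕ-nonneg (suc n) = 0≤+ 0≤1 (fromℕ-nonneg n)

  fromℕ-≥1 : ∀ {n} → n ≢ 0 → 1ℚ ≤ fromℕ n
  fromℕ-≥1 {zero}  n≢0 = contradiction refl n≢0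
  fromℕ-≥1 {suc n} _   = p≤p+q (fromℕ-nonneg n)

  -p≤∣p∣ : ∀ p → - p ≤ ∣ p ∣
  -p≤∣p∣ p with ℚP.∣p∣≡p∨∣p∣≡-p p
  ... | inj₁ ∣p∣≡p  = ℚP.≤-trans (ℚP.neg-antimono-≤ (subst (0ℚ ≤_) ∣p∣≡p (ℚP.0≤∣p∣ p))) (ℚP.0≤∣p∣ p)
  ... | inj₂ ∣p∣≡-p = ℚP.≤-reflexive (sym ∣p∣≡-p)

  -≤⇒0≤+ : ∀ {p q} → - q ≤ p → 0ℚ ≤ p + q
  -≤⇒0≤+ {p} {q} -q≤p = subst (_≤ p + q) (ℚP.+-inverseˡ q) (ℚP.+-monoˡ-≤ q -q≤p)

  +-cancelˡ-≤ : ∀ r {p q} → r + p ≤ r + q → p ≤ q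
  +-cancelˡ-≤ r {p} {q} r+p≤r+q = subst₂ _≤_ (cancel p) (cancel q) (ℚP.+-monoʳ-≤ (- r) r+p≤r+q)
    where
    cancel : ∀ x → - r + (r + x) ≡ x
    cancel = solve 2 (λ r x → :- r :+ (r :+ x) := x) refl r

  -1* : ∀ t → - 1ℚ * t ≡ - t
  -1* = solve 1 (λ t → :- con 1ℚ :* t := :- t) refl

  1/-*-+ : ∀ m .{{_ : ℚ.NonZero m}} t → 1/ m * (m + t) ≡ 1ℚ + 1/ m * t
  1/-*-+ m t = trans (ℚP.*-distribˡ-+ (1/ m) m t) (cong (_+ 1/ m * t) (ℚP.*-inverseˡ m))

  *-1/-cancel : ∀ m .{{_ : ℚ.NonZero m}} t → m * (1/ m * t) ≡ t
  *-1/-cancel m t = trans (sym (ℚP.*-assoc m (1/ m) t))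
    (trans (cong (_* t) (ℚP.*-inverseʳ m)) (ℚP.*-identityˡ t))

  Σ-cong : ∀ {m} {f g : Vecℚ m} → f ≗ g → Σℚ f ≡ Σℚ g
  Σ-cong {zero}  _   = refl
  Σ-cong {suc m} f≗g = cong₂ _+_ (f≗g zero) (Σ-cong (f≗g ∘ suc))

  Σ-zero : ∀ m → Σℚ {m} (λ _ → 0ℚ) ≡ 0ℚ
  Σ-zero zero    = refl
  Σ-zero (suc m) = trans (ℚP.+-identityˡ _) (Σ-zero m)

  Σ-distrib-+ : ∀ {m} (f g : Vecℚ m) → Σℚ (λ a → f a + g a) ≡ Σℚ f + Σℚ g
  Σ-distrib-+ {zero}  f g = refl
  Σ-distrib-+ {suc m} f g = trans (cong (f zero + g zero +_) (Σ-distrib-+ (f ∘ suc) (g ∘ suc)))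
    (solve 4 (λ a b c d → (a :+ b) :+ (c :+ d) := (a :+ c) :+ (b :+ d)) refl
      (f zero) (g zero) (Σℚ (f ∘ suc)) (Σℚ (g ∘ suc)))

  *-distribˡ-Σ : ∀ {m} k (f : Vecℚ m) → Σℚ (λ a → k * f a) ≡ k * Σℚ f
  *-distribˡ-Σ {zero}  k f = sym (ℚP.*-zeroʳ k)
  *-distribˡ-Σ {suc m} k f = trans (cong (k * f zero +_) (*-distribˡ-Σ k (f ∘ suc)))
    (sym (ℚP.*-distribˡ-+ k (f zero) (Σℚ (f ∘ suc))))

  Σ-distrib-neg : ∀ {m} (f : Vecℚ m) → Σℚ (λ a → - f a) ≡ - Σℚ f
  Σ-distrib-neg {zero}  f = refl
  Σ-distrib-neg {suc m} f = trans (cong (- f zero +_) (Σ-distrib-neg (f ∘ suc)))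
    (sym (ℚP.neg-distrib-+ (f zero) (Σℚ (f ∘ suc))))

  Σ-distrib-− : ∀ {m} (f g : Vecℚ m) → Σℚ (λ a → f a - g a) ≡ Σℚ f - Σℚ g
  Σ-distrib-− f g = trans (Σ-distrib-+ f (λ a → - g a)) (cong (Σℚ f +_) (Σ-distrib-neg g))

  Σ-const : ∀ m c → Σℚ {m} (λ _ → c) ≡ fromℕ m * c
  Σ-const zero    c = sym (ℚP.*-zeroˡ c)
  Σ-const (suc m) c = trans (cong (c +_) (Σ-const m c))
    (solve 2 (λ c n → c :+ n :* c := (con 1ℚ :+ n) :* c) refl c (fromℕ m))

  Σ-comm : ∀ {m n} (f : Fin m → Fin n → ℚ) →
    Σℚ (λ i → Σℚ (λ j → f i j)) ≡ Σℚ (λ j → Σℚ (λ i → f i j))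
  Σ-comm {zero}  {n} f = sym (Σ-zero n)
  Σ-comm {suc m}     f = trans (cong (Σℚ (f zero) +_) (Σ-comm (f ∘ suc)))
    (sym (Σ-distrib-+ (f zero) (λ j → Σℚ (λ i → f (suc i) j))))

  Σ-product : ∀ {m n} (f : Vecℚ m) (g : Vecℚ n) → Σℚ (λ i → Σℚ (λ j → f i * g j)) ≡ Σℚ f * Σℚ g
  Σ-product f g = begin
    Σℚ (λ i → Σℚ (λ j → f i * g j))  ≡⟨ Σ-cong (λ i → *-distribˡ-Σ (f i) g) ⟩
    Σℚ (λ i → f i * Σℚ g)            ≡⟨ Σ-cong (λ i → ℚP.*-comm (f i) (Σℚ g)) ⟩
    Σℚ (λ i → Σℚ g * f i)            ≡⟨ *-distribˡ-Σ (Σℚ g) f ⟩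
    Σℚ g * Σℚ f                      ≡⟨ ℚP.*-comm (Σℚ g) (Σℚ f) ⟩
    Σℚ f * Σℚ g                      ∎
    where open ≡-Reasoning

  Σ-mono-≤ : ∀ {m} {f g : Vecℚ m} → (∀ a → f a ≤ g a) → Σℚ f ≤ Σℚ g
  Σ-mono-≤ {zero}  _   = ℚP.≤-refl
  Σ-mono-≤ {suc m} f≤g = ℚP.+-mono-≤ (f≤g zero) (Σ-mono-≤ (f≤g ∘ suc))

  Σ-nonneg : ∀ {m} {f : Vecℚ m} → (∀ a → 0ℚ ≤ f a) → 0ℚ ≤ Σℚ f
  Σ-nonneg {m} {f} 0≤f = subst (_≤ Σℚ f) (Σ-zero m) (Σ-mono-≤ 0≤f)

  term≤Σ : ∀ {m} {f : Vecℚ m} → (∀ a → 0ℚ ≤ f a) → ∀ b → f b ≤ Σℚ f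
  term≤Σ {suc m} 0≤f zero    = p≤p+q (Σ-nonneg (0≤f ∘ suc))
  term≤Σ {suc m} 0≤f (suc b) = ℚP.≤-trans (term≤Σ (0≤f ∘ suc) b) (p≤q+p (0≤f zero))

  Σ-nonneg-zero : ∀ {m} {f : Vecℚ m} → (∀ a → 0ℚ ≤ f a) → Σℚ f ≡ 0ℚ → ∀ a → f a ≡ 0ℚ
  Σ-nonneg-zero f≥0 Σf≡0 a = ℚP.≤-antisym (subst (_ ≤_) Σf≡0 (term≤Σ f≥0 a)) (f≥0 a)

  small-multiple : ∀ {m δ₀} → 0ℚ < δ₀ → (u : Vecℚ m) → ∃ λ ε → 0ℚ < ε × (∀ a → ε * ∣ u a ∣ ≤ δ₀)
  small-multiple {δ₀ = δ₀} δ₀>0 u = δ₀ * 1/ B , ε>0 , ε∣u∣≤δ₀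
    where
    B = 1ℚ + Σℚ (λ a → ∣ u a ∣)
    ∣u∣≤B : ∀ a → ∣ u a ∣ ≤ B
    ∣u∣≤B a = ℚP.≤-trans (term≤Σ (ℚP.0≤∣p∣ ∘ u) a) (p≤q+p 0≤1)
    instance
      B>0 : ℚ.Positive B
      B>0 = ℚ.positive (ℚP.<-≤-trans (ℚP.positive⁻¹ 1ℚ) (p≤p+q (Σ-nonneg (ℚP.0≤∣p∣ ∘ u))))
      B≢0 : ℚ.NonZero B
      B≢0 = ℚP.pos⇒nonZero B
    ε>0 : 0ℚ < δ₀ * 1/ B
    ε>0 = ℚP.positive⁻¹ _ {{ℚP.pos*pos⇒pos δ₀ {{ℚ.positive δ₀>0}} (1/ B) {{ℚP.1/pos⇒pos B}}}}
    ε∣u∣≤δ₀ : ∀ a → δ₀ * 1/ B * ∣ u a ∣ ≤ δ₀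
    ε∣u∣≤δ₀ a = begin
      δ₀ * 1/ B * ∣ u a ∣  ≤⟨ ℚP.*-monoˡ-≤-nonNeg (δ₀ * 1/ B) {{ℚ.nonNegative (ℚP.<⇒≤ ε>0)}} (∣u∣≤B a) ⟩
      δ₀ * 1/ B * B        ≡⟨ ℚP.*-assoc δ₀ (1/ B) B ⟩
      δ₀ * (1/ B * B)      ≡⟨ cong (δ₀ *_) (ℚP.*-inverseˡ B) ⟩
      δ₀ * 1ℚ              ≡⟨ ℚP.*-identityʳ δ₀ ⟩
      δ₀                   ∎
      where open ℚP.≤-Reasoning

  argmax-Fin : ∀ {m} (f : Vecℚ m) → Fin m → ∃ λ b → ∀ a → f a ≤ f b
  argmax-Fin {m} f a₀ = argmax f a₀ (allFin m) ,
    λ a → All.lookup (f[xs]≤f[argmax] a₀ (allFin m)) (∈-allFin a)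

  𝕖 : ∀ {m} → Fin m → Vecℚ m
  𝕖 a b = if does (a ≟ b) then 1ℚ else 0ℚ

  𝕖-diag : ∀ {m} (a : Fin m) → 𝕖 a a ≡ 1ℚ
  𝕖-diag a with a ≟ a
  ... | yes _  = refl
  ... | no a≢a = contradiction refl a≢a

  𝕖-off : ∀ {m} {a b : Fin m} → a ≢ b → 𝕖 a b ≡ 0ℚ
  𝕖-off {a = a} {b} a≢b with a ≟ b
  ... | yes a≡b = contradiction a≡b a≢b
  ... | no _    = refl

  𝕖-sym : ∀ {m} (a b : Fin m) → 𝕖 a b ≡ 𝕖 b a
  𝕖-sym a b with a ≟ b
  ... | yes refl = sym (𝕖-diag a)
  ... | no a≢b   = sym (𝕖-off (a≢b ∘ sym))

  𝕖-nonneg : ∀ {m} (a b : Fin m) → 0ℚ ≤ 𝕖 a b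
  𝕖-nonneg a b with does (a ≟ b)
  ... | true  = 0≤1
  ... | false = ℚP.≤-refl

  𝕖-injective : ∀ {k m} {f : Fin k → Fin m} → (∀ {s s'} → f s ≡ f s' → s ≡ s') →
    ∀ s s' → 𝕖 (f s) (f s') ≡ 𝕖 s s'
  𝕖-injective {f = f} f-inj s s' with s ≟ s'
  ... | yes refl = 𝕖-diag (f s)
  ... | no s≢s'  = 𝕖-off (s≢s' ∘ f-inj)

  if-≟-then-else-0 : ∀ {m} (a b : Fin m) x → (if does (a ≟ b) then x else 0ℚ) ≡ 𝕖 a b * x
  if-≟-then-else-0 a b x with does (a ≟ b)
  ... | true  = sym (ℚP.*-identityˡ x)
  ... | false = sym (ℚP.*-zeroˡ x)

  ⟪𝕖⟫ : ∀ {m} (a : Fin m) (f : Vecℚ m) → ⟪ 𝕖 a , f ⟫ ≡ f a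
  ⟪𝕖⟫ {suc m} zero f = begin
    1ℚ * f zero + Σℚ (λ b → 0ℚ * f (suc b))  ≡⟨ cong₂ _+_ (ℚP.*-identityˡ (f zero)) (Σ-cong (λ b → ℚP.*-zeroˡ (f (suc b)))) ⟩
    f zero + Σℚ {m} (λ _ → 0ℚ)              ≡⟨ cong (f zero +_) (Σ-zero m) ⟩
    f zero + 0ℚ                             ≡⟨ ℚP.+-identityʳ (f zero) ⟩
    f zero                                  ∎
    where open ≡-Reasoning
  ⟪𝕖⟫ {suc m} (suc a) f = trans (cong₂ _+_ (ℚP.*-zeroˡ (f zero)) (⟪𝕖⟫ a (f ∘ suc))) (ℚP.+-identityˡ _)

  Σ-𝕖 : ∀ {m} (a : Fin m) → Σℚ (λ b → 𝕖 b a) ≡ 1ℚ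
  Σ-𝕖 a = trans (Σ-cong (λ b → trans (𝕖-sym b a) (sym (ℚP.*-identityʳ (𝕖 a b))))) (⟪𝕖⟫ a (λ _ → 1ℚ))

  𝕖-diff-diag : ∀ {m} {i r : Fin m} → i ≢ r → 𝕖 i r - 𝕖 r r ≡ - 1ℚ
  𝕖-diff-diag {r = r} i≢r = cong₂ _-_ (𝕖-off i≢r) (𝕖-diag r)

  𝕖-diff-off : ∀ {m} (i : Fin m) {r u : Fin m} → r ≢ u → 𝕖 i u - 𝕖 r u ≡ 𝕖 i u
  𝕖-diff-off i {u = u} r≢u = trans (cong (_-_ (𝕖 i u)) (𝕖-off r≢u)) (ℚP.+-identityʳ (𝕖 i u))

  Σ-𝕖-diff : ∀ {m} (u r : Fin m) → Σℚ (λ i → 𝕖 i u - 𝕖 r u) ≡ 1ℚ - fromℕ m * 𝕖 r u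
  Σ-𝕖-diff {m} u r = trans (Σ-distrib-− (λ i → 𝕖 i u) (λ _ → 𝕖 r u))
    (cong₂ _-_ (Σ-𝕖 u) (Σ-const m (𝕖 r u)))

  infixl 6 _+ᵥ_
  infixl 7 _*ᵥ_

  _+ᵥ_ : ∀ {m} → Vecℚ m → Vecℚ m → Vecℚ m
  (x +ᵥ y) a = x a + y a

  _*ᵥ_ : ∀ {m} → ℚ → Vecℚ m → Vecℚ m
  (k *ᵥ x) a = k * x a

  lincomb : ∀ {k m} → (Fin k → ℚ) → (Fin k → Vecℚ m) → Vecℚ m
  lincomb t ws a = Σℚ (λ j → t j * ws j a)

  −𝕖 : ∀ {m} → Fin m → Vecℚ m
  −𝕖 a b = - 𝕖 a b

  module _ {m : ℕ} where

    ⟪⟫-comm : (c x : Vecℚ m) → ⟪ c , x ⟫ ≡ ⟪ x , c ⟫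
    ⟪⟫-comm c x = Σ-cong (λ a → ℚP.*-comm (c a) (x a))

    ⟪⟫-congʳ : (c : Vecℚ m) {x y : Vecℚ m} → x ≗ y → ⟪ c , x ⟫ ≡ ⟪ c , y ⟫
    ⟪⟫-congʳ c x≗y = Σ-cong (λ a → cong (c a *_) (x≗y a))

    ⟪⟫-zeroʳ : (c : Vecℚ m) {x : Vecℚ m} → (∀ a → x a ≡ 0ℚ) → ⟪ c , x ⟫ ≡ 0ℚ
    ⟪⟫-zeroʳ c x≡0 = trans (Σ-cong (λ a → trans (cong (c a *_) (x≡0 a)) (ℚP.*-zeroʳ (c a)))) (Σ-zero m)

    ⟪⟫-+ʳ : (c x y : Vecℚ m) → ⟪ c , x +ᵥ y ⟫ ≡ ⟪ c , x ⟫ + ⟪ c , y ⟫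
    ⟪⟫-+ʳ c x y = trans (Σ-cong (λ a → ℚP.*-distribˡ-+ (c a) (x a) (y a)))
      (Σ-distrib-+ (λ a → c a * x a) (λ a → c a * y a))

    ⟪⟫-−ʳ : (c x y : Vecℚ m) → ⟪ c , x −ᵥ y ⟫ ≡ ⟪ c , x ⟫ - ⟪ c , y ⟫
    ⟪⟫-−ʳ c x y = trans (Σ-cong (λ a → solve 3 (λ c x y → c :* (x :- y) := c :* x :- c :* y) refl (c a) (x a) (y a)))
      (Σ-distrib-− (λ a → c a * x a) (λ a → c a * y a))

    ⟪⟫-*ʳ : (c : Vecℚ m) (k : ℚ) (x : Vecℚ m) → ⟪ c , k *ᵥ x ⟫ ≡ k * ⟪ c , x ⟫
    ⟪⟫-*ʳ c k x = trans (Σ-cong (λ a → solve 3 (λ c k x → c :* (k :* x) := k :* (c :* x)) refl (c a) k (x a)))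
      (*-distribˡ-Σ k (λ a → c a * x a))

    ⟪⟫-Σʳ : ∀ {k} (c : Vecℚ m) (ws : Fin k → Vecℚ m) →
      ⟪ c , (λ a → Σℚ (λ j → ws j a)) ⟫ ≡ Σℚ (λ j → ⟪ c , ws j ⟫)
    ⟪⟫-Σʳ c ws = trans (Σ-cong (λ a → sym (*-distribˡ-Σ (c a) (λ j → ws j a))))
      (Σ-comm (λ a j → c a * ws j a))

    ⟪⟫-lincombʳ : ∀ {k} (c : Vecℚ m) (t : Fin k → ℚ) (ws : Fin k → Vecℚ m) →
      ⟪ c , lincomb t ws ⟫ ≡ Σℚ (λ j → t j * ⟪ c , ws j ⟫)
    ⟪⟫-lincombʳ c t ws = trans (⟪⟫-Σʳ c (λ j → t j *ᵥ ws j)) (Σ-cong (λ j → ⟪⟫-*ʳ c (t j) (ws j)))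

    ⟪⟫-lincombˡ : ∀ {k} (t : Fin k → ℚ) (vs : Fin k → Vecℚ m) (x : Vecℚ m) →
      ⟪ lincomb t vs , x ⟫ ≡ Σℚ (λ j → t j * ⟪ vs j , x ⟫)
    ⟪⟫-lincombˡ t vs x = trans (⟪⟫-comm (lincomb t vs) x)
      (trans (⟪⟫-lincombʳ x t vs) (Σ-cong (λ j → cong (t j *_) (⟪⟫-comm x (vs j)))))

    ⟪−𝕖⟫ : (a : Fin m) (x : Vecℚ m) → ⟪ −𝕖 a , x ⟫ ≡ - x a
    ⟪−𝕖⟫ a x = trans (Σ-cong (λ b → sym (ℚP.neg-distribˡ-* (𝕖 a b) (x b))))
      (trans (Σ-distrib-neg (λ b → 𝕖 a b * x b)) (cong -_ (⟪𝕖⟫ a x)))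

  -- The incidence map, flows and the polar polytope

  module _ (Q : Quiver) where

    ∂ : Fin (nV Q) → Vecℚ (nA Q)
    ∂ v a = 𝕖 (head Q a) v - 𝕖 (tail Q a) v

    inc≡⟪∂⟫ : ∀ f v → inc Q f v ≡ ⟪ ∂ v , f ⟫
    inc≡⟪∂⟫ f v = begin
      inc Q f v
        ≡⟨ cong₂ _-_ (Σ-cong (λ a → if-≟-then-else-0 (head Q a) v (f a)))
                     (Σ-cong (λ a → if-≟-then-else-0 (tail Q a) v (f a))) ⟩
      Σℚ (λ a → 𝕖 (head Q a) v * f a) - Σℚ (λ a → 𝕖 (tail Q a) v * f a)
        ≡⟨ sym (Σ-distrib-− (λ a → 𝕖 (head Q a) v * f a) (λ a → 𝕖 (tail Q a) v * f a)) ⟩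
      Σℚ (λ a → 𝕖 (head Q a) v * f a - 𝕖 (tail Q a) v * f a)
        ≡⟨ Σ-cong (λ a → solve 3 (λ h t x → h :* x :- t :* x := (h :- t) :* x) refl
                           (𝕖 (head Q a) v) (𝕖 (tail Q a) v) (f a)) ⟩
      ⟪ ∂ v , f ⟫
        ∎
      where open ≡-Reasoning

    inc-cong : ∀ {x y} → x ≗ y → ∀ v → inc Q x v ≡ inc Q y v
    inc-cong {x} {y} x≗y v = trans (inc≡⟪∂⟫ x v) (trans (⟪⟫-congʳ (∂ v) x≗y) (sym (inc≡⟪∂⟫ y v)))

    inc-𝕖 : ∀ a v → inc Q (𝕖 a) v ≡ 𝕖 (head Q a) v - 𝕖 (tail Q a) v
    inc-𝕖 a v = trans (inc≡⟪∂⟫ (𝕖 a) v) (trans (⟪⟫-comm (∂ v) (𝕖 a)) (⟪𝕖⟫ a (∂ v)))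

    ⟪⟫-inc : ∀ (φ : Vecℚ (nV Q)) f → ⟪ φ , inc Q f ⟫ ≡ ⟪ (λ a → φ (head Q a) - φ (tail Q a)) , f ⟫
    ⟪⟫-inc φ f = begin
      ⟪ φ , inc Q f ⟫                                   ≡⟨ ⟪⟫-congʳ φ (inc≡⟪∂⟫ f) ⟩
      ⟪ φ , (λ v → Σℚ (λ a → ∂ v a * f a)) ⟫            ≡⟨ ⟪⟫-Σʳ φ (λ a v → ∂ v a * f a) ⟩
      Σℚ (λ a → ⟪ φ , (λ v → ∂ v a * f a) ⟫)            ≡⟨ Σ-cong (λ a → ⟪⟫-congʳ φ (λ v → ℚP.*-comm (∂ v a) (f a))) ⟩
      Σℚ (λ a → ⟪ φ , f a *ᵥ (λ v → ∂ v a) ⟫)           ≡⟨ Σ-cong (λ a → ⟪⟫-*ʳ φ (f a) (λ v → ∂ v a)) ⟩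
      Σℚ (λ a → f a * ⟪ φ , 𝕖 (head Q a) −ᵥ 𝕖 (tail Q a) ⟫) ≡⟨ Σ-cong (λ a → cong (f a *_) (⟪φ,∂⟫ a)) ⟩
      Σℚ (λ a → f a * (φ (head Q a) - φ (tail Q a)))    ≡⟨ ⟪⟫-comm f _ ⟩
      ⟪ (λ a → φ (head Q a) - φ (tail Q a)) , f ⟫       ∎
      where
      open ≡-Reasoning
      ⟪φ,𝕖⟫ : ∀ v → ⟪ φ , 𝕖 v ⟫ ≡ φ v
      ⟪φ,𝕖⟫ v = trans (⟪⟫-comm φ (𝕖 v)) (⟪𝕖⟫ v φ)
      ⟪φ,∂⟫ : ∀ a → ⟪ φ , 𝕖 (head Q a) −ᵥ 𝕖 (tail Q a) ⟫ ≡ φ (head Q a) - φ (tail Q a)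
      ⟪φ,∂⟫ a = trans (⟪⟫-−ʳ φ (𝕖 (head Q a)) (𝕖 (tail Q a))) (cong₂ _-_ (⟪φ,𝕖⟫ (head Q a)) (⟪φ,𝕖⟫ (tail Q a)))

    inc-+ : ∀ x y v → inc Q (x +ᵥ y) v ≡ inc Q x v + inc Q y v
    inc-+ x y v = trans (inc≡⟪∂⟫ (x +ᵥ y) v)
      (trans (⟪⟫-+ʳ (∂ v) x y) (sym (cong₂ _+_ (inc≡⟪∂⟫ x v) (inc≡⟪∂⟫ y v))))

    inc-− : ∀ x y v → inc Q (x −ᵥ y) v ≡ inc Q x v - inc Q y v
    inc-− x y v = trans (inc≡⟪∂⟫ (x −ᵥ y) v)
      (trans (⟪⟫-−ʳ (∂ v) x y) (sym (cong₂ _-_ (inc≡⟪∂⟫ x v) (inc≡⟪∂⟫ y v))))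

    ker-zero : InKer Q (λ _ → 0ℚ)
    ker-zero v = trans (inc≡⟪∂⟫ (λ _ → 0ℚ) v) (⟪⟫-zeroʳ (∂ v) (λ _ → refl))

    ker-* : ∀ {x} k → InKer Q x → InKer Q (k *ᵥ x)
    ker-* {x} k x∈ker v = begin
      inc Q (k *ᵥ x) v     ≡⟨ inc≡⟪∂⟫ (k *ᵥ x) v ⟩
      ⟪ ∂ v , k *ᵥ x ⟫     ≡⟨ ⟪⟫-*ʳ (∂ v) k x ⟩
      k * ⟪ ∂ v , x ⟫      ≡⟨ cong (k *_) (trans (sym (inc≡⟪∂⟫ x v)) (x∈ker v)) ⟩
      k * 0ℚ               ≡⟨ ℚP.*-zeroʳ k ⟩
      0ℚ                   ∎
      where open ≡-Reasoning

    ker-− : ∀ {x y} → InKer Q x → InKer Q y → InKer Q (x −ᵥ y)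
    ker-− {x} {y} x∈ker y∈ker v = trans (inc-− x y v) (cong₂ _-_ (x∈ker v) (y∈ker v))

    ker-Σ : ∀ {k} (ws : Fin k → Vecℚ (nA Q)) → (∀ j → InKer Q (ws j)) →
      InKer Q (λ a → Σℚ (λ j → ws j a))
    ker-Σ {k} ws ws∈ker v = begin
      inc Q (λ a → Σℚ (λ j → ws j a)) v   ≡⟨ inc≡⟪∂⟫ _ v ⟩
      ⟪ ∂ v , (λ a → Σℚ (λ j → ws j a)) ⟫ ≡⟨ ⟪⟫-Σʳ (∂ v) ws ⟩
      Σℚ (λ j → ⟪ ∂ v , ws j ⟫)           ≡⟨ Σ-cong (λ j → trans (sym (inc≡⟪∂⟫ (ws j) v)) (ws∈ker j v)) ⟩
      Σℚ {k} (λ _ → 0ℚ)                   ≡⟨ Σ-zero k ⟩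
      0ℚ                                  ∎
      where open ≡-Reasoning

    ker-lincomb : ∀ {k} (t : Fin k → ℚ) (ws : Fin k → Vecℚ (nA Q)) → (∀ j → InKer Q (ws j)) →
      InKer Q (lincomb t ws)
    ker-lincomb t ws ws∈ker = ker-Σ (λ j → t j *ᵥ ws j) (λ j → ker-* (t j) (ws∈ker j))

    IsFlow : Vecℚ (nA Q) → Set
    IsFlow y = ∀ v → inc Q y v ≡ δ Q v

    flow-+ker : ∀ {y u} → IsFlow y → InKer Q u → IsFlow (y +ᵥ u)
    flow-+ker {y} {u} y-flow u∈ker v = trans (inc-+ y u v)
      (trans (cong₂ _+_ (y-flow v) (u∈ker v)) (ℚP.+-identityʳ (δ Q v)))

    flow−𝟏∈ker : ∀ {y} → IsFlow y → InKer Q (y −ᵥ 𝟏)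
    flow−𝟏∈ker {y} y-flow v = trans (inc-− y 𝟏 v)
      (trans (cong (_- δ Q v) (y-flow v)) (ℚP.+-inverseʳ (δ Q v)))

    Same-refl : ∀ c → Same Q c c
    Same-refl _ _ _ = refl

    Same-sym : ∀ {c c'} → Same Q c c' → Same Q c' c
    Same-sym c≈c' x x∈ker = sym (c≈c' x x∈ker)

    Same-trans : ∀ {c c' c''} → Same Q c c' → Same Q c' c'' → Same Q c c''
    Same-trans c≈c' c'≈c'' x x∈ker = trans (c≈c' x x∈ker) (c'≈c'' x x∈ker)

    polar-resp-Same : ∀ {c c'} → Same Q c c' → InPolar Q c' → InPolar Q c
    polar-resp-Same c≈c' c'∈polar y y∈P =
      subst (_≤ 1ℚ) (sym (c≈c' (y −ᵥ 𝟏) (flow−𝟏∈ker (proj₂ y∈P)))) (c'∈polar y y∈P)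

    −𝕖∈polar : ∀ a → InPolar Q (−𝕖 a)
    −𝕖∈polar a y (y≥0 , _) = begin
      ⟪ −𝕖 a , y −ᵥ 𝟏 ⟫  ≡⟨ ⟪−𝕖⟫ a (y −ᵥ 𝟏) ⟩
      - (y a - 1ℚ)       ≡⟨ solve 1 (λ y → :- (y :- con 1ℚ) := con 1ℚ :- y) refl (y a) ⟩
      1ℚ - y a           ≤⟨ ℚP.+-monoʳ-≤ 1ℚ (ℚP.neg-antimono-≤ (y≥0 a)) ⟩
      1ℚ + - 0ℚ          ≡⟨⟩
      1ℚ                 ∎
      where open ℚP.≤-Reasoning

    lincomb∈polar : ∀ {k} {t : Fin k → ℚ} {vs : Fin k → Vecℚ (nA Q)} →
      (∀ j → 0ℚ ≤ t j) → Σℚ t ≡ 1ℚ → (∀ j → InPolar Q (vs j)) → InPolar Q (lincomb t vs)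
    lincomb∈polar {t = t} {vs} t≥0 Σt≡1 vs∈polar y y∈P = begin
      ⟪ lincomb t vs , y −ᵥ 𝟏 ⟫           ≡⟨ ⟪⟫-lincombˡ t vs (y −ᵥ 𝟏) ⟩
      Σℚ (λ j → t j * ⟪ vs j , y −ᵥ 𝟏 ⟫)  ≤⟨ Σ-mono-≤ (λ j → ℚP.*-monoˡ-≤-nonNeg (t j) {{ℚ.nonNegative (t≥0 j)}} (vs∈polar j y y∈P)) ⟩
      Σℚ (λ j → t j * 1ℚ)                 ≡⟨ Σ-cong (λ j → ℚP.*-identityʳ (t j)) ⟩
      Σℚ t                                ≡⟨ Σt≡1 ⟩
      1ℚ                                  ∎
      where open ℚP.≤-Reasoning

    module _ (Σ-ker : ∀ x → InKer Q x → Σℚ x ≡ 0ℚ) (a₀ : Fin (nA Q)) where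

      -- For m > 0 the point 𝟏 + x/m lies in P; for m ≤ 0, x ≥ 0 has zero sum and so vanishes.
      polar-≤ : ∀ {x m} → InKer Q x → (∀ a → - x a ≤ m) → ∀ c → InPolar Q c → ⟪ c , x ⟫ ≤ m
      polar-≤ {x} {m} x∈ker -x≤m c c∈polar with 0ℚ ℚP.<? m
      ... | yes 0<m = begin
        ⟪ c , x ⟫               ≡⟨ sym (*-1/-cancel m ⟪ c , x ⟫) ⟩
        m * (1/ m * ⟪ c , x ⟫)  ≤⟨ ℚP.*-monoˡ-≤-nonNeg m {{ℚ.nonNegative (ℚP.<⇒≤ 0<m)}} ⟪c,x/m⟫≤1 ⟩
        m * 1ℚ                  ≡⟨ ℚP.*-identityʳ m ⟩
        m                       ∎
        where
        open ℚP.≤-Reasoning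
        instance
          m>0 : ℚ.Positive m
          m>0 = ℚ.positive 0<m
          m≢0 : ℚ.NonZero m
          m≢0 = ℚP.pos⇒nonZero m
        z : Vecℚ (nA Q)
        z = 𝟏 +ᵥ 1/ m *ᵥ x
        z≥0 : ∀ a → 0ℚ ≤ z a
        z≥0 a = subst (0ℚ ≤_) (1/-*-+ m (x a))
          (0≤* (ℚP.<⇒≤ (ℚP.positive⁻¹ (1/ m) {{ℚP.1/pos⇒pos m}}))
               (subst (0ℚ ≤_) (cong (m +_) (-‿involutive (x a))) (≤⇒0≤- (-x≤m a))))
        ⟪c,x/m⟫≤1 : 1/ m * ⟪ c , x ⟫ ≤ 1ℚ
        ⟪c,x/m⟫≤1 = subst (_≤ 1ℚ)
          (trans (⟪⟫-congʳ c (λ a → solve 1 (λ u → (con 1ℚ :+ u) :- con 1ℚ := u) refl (1/ m * x a)))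
                 (⟪⟫-*ʳ c (1/ m) x))
          (c∈polar z (z≥0 , flow-+ker (λ _ → refl) (ker-* (1/ m) x∈ker)))
      ... | no 0≮m = subst (_≤ m) (trans (cong -_ (x≡0 a₀)) (sym (⟪⟫-zeroʳ c x≡0))) (-x≤m a₀)
        where
        x≥0 : ∀ a → 0ℚ ≤ x a
        x≥0 a = subst (0ℚ ≤_) (-‿involutive (x a)) (ℚP.neg-antimono-≤ (ℚP.≤-trans (-x≤m a) (ℚP.≮⇒≥ 0≮m)))
        x≡0 : ∀ a → x a ≡ 0ℚ
        x≡0 = Σ-nonneg-zero x≥0 (Σ-ker x x∈ker)

      vertex⇒−𝕖 : ∀ v → IsVertex Q v → ∃ λ a → Same Q v (−𝕖 a)
      vertex⇒−𝕖 v (face⊆polar , x , b , x∈ker , polar≤b , face-attains , attains⇒face) =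
        a* , Same-sym {−𝕖 a*} {v} (attains⇒face (−𝕖 a*) (−𝕖∈polar a*) −𝕖a*-attains)
        where
        a* = proj₁ (argmax-Fin (λ a → - x a) a₀)
        b≤-xa* : b ≤ - x a*
        b≤-xa* = subst (_≤ - x a*) (face-attains v (Same-refl v))
          (polar-≤ x∈ker (proj₂ (argmax-Fin (λ a → - x a) a₀)) v (face⊆polar v (Same-refl v)))
        −𝕖a*-attains : ⟪ −𝕖 a* , x ⟫ ≡ b
        −𝕖a*-attains = ℚP.≤-antisym (polar≤b (−𝕖 a*) (−𝕖∈polar a*))
          (subst (b ≤_) (sym (⟪−𝕖⟫ a* x)) b≤-xa*)

  -- A face criterion

  module FaceCriterion
    (Q : Quiver) {k : ℕ} (arr : Fin k → Fin (nA Q))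
    (y : Vecℚ (nA Q)) (y-flow : IsFlow Q y) (y-arr : ∀ s → y (arr s) ≡ 0ℚ)
    {δ₀ : ℚ} (δ₀>0 : 0ℚ < δ₀) (y-off : ∀ a → (∃ λ s → arr s ≡ a) ⊎ δ₀ ≤ y a)
    (C : Fin k → Vecℚ (nA Q)) (C-ker : ∀ s → InKer Q (C s)) (C-arr : ∀ s s' → C s (arr s') ≡ 𝕖 s s')
    where

    y≥0 : ∀ a → 0ℚ ≤ y a
    y≥0 a with y-off a
    ... | inj₁ (s , refl) = ℚP.≤-reflexive (sym (y-arr s))
    ... | inj₂ δ₀≤ya      = ℚP.≤-trans (ℚP.<⇒≤ δ₀>0) δ₀≤ya

    x : Vecℚ (nA Q)
    x = y −ᵥ 𝟏

    x-arr : ∀ s → x (arr s) ≡ - 1ℚ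
    x-arr s = trans (cong (_- 1ℚ) (y-arr s)) (ℚP.+-identityˡ (- 1ℚ))

    module _ (c : Vecℚ (nA Q)) (c∈polar : InPolar Q c) (⟪c,x⟫≡1 : ⟪ c , x ⟫ ≡ 1ℚ) where

      -- Since y ≥ δ₀ off the arrows arr s, y + εu stays in P for small ε > 0.
      ⟪c,u⟫≤0 : ∀ u → InKer Q u → (∀ s → 0ℚ ≤ u (arr s)) → ⟪ c , u ⟫ ≤ 0ℚ
      ⟪c,u⟫≤0 u u∈ker u-arr≥0 = ℚP.*-cancelˡ-≤-pos ε {{ℚ.positive ε>0}}
        (subst (ε * ⟪ c , u ⟫ ≤_) (sym (ℚP.*-zeroʳ ε)) (+-cancelˡ-≤ 1ℚ 1+ε⟪c,u⟫≤1))
        where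
        ε = proj₁ (small-multiple δ₀>0 u)
        ε>0 = proj₁ (proj₂ (small-multiple δ₀>0 u))
        ε∣u∣≤δ₀ = proj₂ (proj₂ (small-multiple δ₀>0 u))
        z≥0 : ∀ a → 0ℚ ≤ y a + ε * u a
        z≥0 a with y-off a
        ... | inj₁ (s , refl) = subst (_≤ y (arr s) + ε * u (arr s))
          (cong (_+ 0ℚ) (y-arr s)) (ℚP.+-monoʳ-≤ (y (arr s)) (0≤* (ℚP.<⇒≤ ε>0) (u-arr≥0 s)))
        ... | inj₂ δ₀≤ya = -≤⇒0≤+ (begin
          - (ε * u a)  ≡⟨ ℚP.neg-distribʳ-* ε (u a) ⟩
          ε * - u a    ≤⟨ ℚP.*-monoˡ-≤-nonNeg ε {{ℚ.nonNegative (ℚP.<⇒≤ ε>0)}} (-p≤∣p∣ (u a)) ⟩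
          ε * ∣ u a ∣  ≤⟨ ε∣u∣≤δ₀ a ⟩
          δ₀           ≤⟨ δ₀≤ya ⟩
          y a          ∎)
          where open ℚP.≤-Reasoning
        regroup : ∀ y e u → (y + e * u) - 1ℚ ≡ (y - 1ℚ) + e * u
        regroup = solve 3 (λ y e u → (y :+ e :* u) :- con 1ℚ := (y :- con 1ℚ) :+ e :* u) refl
        1+ε⟪c,u⟫≤1 : 1ℚ + ε * ⟪ c , u ⟫ ≤ 1ℚ + 0ℚ
        1+ε⟪c,u⟫≤1 = subst (_≤ 1ℚ) (begin-equality
          ⟪ c , (y +ᵥ ε *ᵥ u) −ᵥ 𝟏 ⟫    ≡⟨ ⟪⟫-congʳ c (λ a → regroup (y a) ε (u a)) ⟩
          ⟪ c , x +ᵥ ε *ᵥ u ⟫           ≡⟨ ⟪⟫-+ʳ c x (ε *ᵥ u) ⟩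
          ⟪ c , x ⟫ + ⟪ c , ε *ᵥ u ⟫    ≡⟨ cong₂ _+_ ⟪c,x⟫≡1 (⟪⟫-*ʳ c ε u) ⟩
          1ℚ + ε * ⟪ c , u ⟫            ∎)
          (c∈polar (y +ᵥ ε *ᵥ u) (z≥0 , flow-+ker Q y-flow (ker-* Q ε u∈ker)))
          where open ℚP.≤-Reasoning

      ⟪c,u⟫≡0 : ∀ u → InKer Q u → (∀ s → u (arr s) ≡ 0ℚ) → ⟪ c , u ⟫ ≡ 0ℚ
      ⟪c,u⟫≡0 u u∈ker u-arr≡0 = ℚP.≤-antisym (⟪c,u⟫≤0 u u∈ker (ℚP.≤-reflexive ∘ sym ∘ u-arr≡0)) 0≤⟪c,u⟫
        where
        -u-arr≥0 : ∀ s → 0ℚ ≤ - 1ℚ * u (arr s)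
        -u-arr≥0 s = ℚP.≤-reflexive (sym (trans (cong (- 1ℚ *_) (u-arr≡0 s)) (ℚP.*-zeroʳ (- 1ℚ))))
        0≤⟪c,u⟫ : 0ℚ ≤ ⟪ c , u ⟫
        0≤⟪c,u⟫ = begin
          0ℚ                        ≤⟨ ℚP.neg-antimono-≤ (⟪c,u⟫≤0 (- 1ℚ *ᵥ u) (ker-* Q (- 1ℚ) u∈ker) -u-arr≥0) ⟩
          - ⟪ c , - 1ℚ *ᵥ u ⟫       ≡⟨ cong -_ (⟪⟫-*ʳ c (- 1ℚ) u) ⟩
          - (- 1ℚ * ⟪ c , u ⟫)      ≡⟨ solve 1 (λ t → :- (:- con 1ℚ :* t) := t) refl ⟪ c , u ⟫ ⟩
          ⟪ c , u ⟫                 ∎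
          where open ℚP.≤-Reasoning

      ⟪c,w⟫-expand : ∀ w → InKer Q w → ⟪ c , w ⟫ ≡ Σℚ (λ s → w (arr s) * ⟪ c , C s ⟫)
      ⟪c,w⟫-expand w w∈ker = p-q≡0⇒p≡q _ _ (begin
        ⟪ c , w ⟫ - Σℚ (λ s → w (arr s) * ⟪ c , C s ⟫)  ≡⟨ cong (_-_ ⟪ c , w ⟫) (⟪⟫-lincombʳ c (w ∘ arr) C) ⟨
        ⟪ c , w ⟫ - ⟪ c , lincomb (w ∘ arr) C ⟫         ≡⟨ ⟪⟫-−ʳ c w (lincomb (w ∘ arr) C) ⟨
        ⟪ c , w −ᵥ lincomb (w ∘ arr) C ⟫                ≡⟨ ⟪c,u⟫≡0 _ residual-ker residual-arr ⟩
        0ℚ                                              ∎)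
        where
        open ≡-Reasoning
        residual-ker : InKer Q (w −ᵥ lincomb (w ∘ arr) C)
        residual-ker = ker-− Q w∈ker (ker-lincomb Q (w ∘ arr) C C-ker)
        residual-arr : ∀ s' → w (arr s') - lincomb (w ∘ arr) C (arr s') ≡ 0ℚ
        residual-arr s' = begin
          w (arr s') - Σℚ (λ s → w (arr s) * C s (arr s'))  ≡⟨ cong (_-_ (w (arr s'))) (Σ-cong (λ s →
                                                                trans (cong (w (arr s) *_) (trans (C-arr s s') (𝕖-sym s s')))
                                                                      (ℚP.*-comm (w (arr s)) (𝕖 s' s)))) ⟩
          w (arr s') - Σℚ (λ s → 𝕖 s' s * w (arr s))        ≡⟨ cong (_-_ (w (arr s'))) (⟪𝕖⟫ s' (w ∘ arr)) ⟩
          w (arr s') - w (arr s')                           ≡⟨ ℚP.+-inverseʳ (w (arr s')) ⟩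
          0ℚ                                                ∎

    hull-is-face : (vs : Fin k → Vecℚ (nA Q)) → (∀ s → Same Q (vs s) (−𝕖 (arr s))) →
      IsFace Q (InConvHull Q vs)
    hull-is-face vs vs≈−𝕖 =
      hull⊆polar , x , 1ℚ , flow−𝟏∈ker Q y-flow , (λ c c∈polar → c∈polar y (y≥0 , y-flow)) ,
      hull-attains , attains⇒hull
      where
      ⟪vs,w⟫ : ∀ s w → InKer Q w → ⟪ vs s , w ⟫ ≡ - w (arr s)
      ⟪vs,w⟫ s w w∈ker = trans (vs≈−𝕖 s w w∈ker) (⟪−𝕖⟫ (arr s) w)

      ⟪vs,x⟫≡1 : ∀ s → ⟪ vs s , x ⟫ ≡ 1ℚ
      ⟪vs,x⟫≡1 s = trans (⟪vs,w⟫ s x (flow−𝟏∈ker Q y-flow)) (cong -_ (x-arr s))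

      hull⊆polar : ∀ c → InConvHull Q vs c → InPolar Q c
      hull⊆polar c (t , t≥0 , Σt≡1 , c≈) = polar-resp-Same Q {c} {lincomb t vs} c≈
        (lincomb∈polar Q t≥0 Σt≡1 (λ s → polar-resp-Same Q {vs s} {−𝕖 (arr s)} (vs≈−𝕖 s) (−𝕖∈polar Q (arr s))))

      hull-attains : ∀ c → InConvHull Q vs c → ⟪ c , x ⟫ ≡ 1ℚ
      hull-attains c (t , _ , Σt≡1 , c≈) = begin
        ⟪ c , x ⟫                      ≡⟨ c≈ x (flow−𝟏∈ker Q y-flow) ⟩
        ⟪ lincomb t vs , x ⟫           ≡⟨ ⟪⟫-lincombˡ t vs x ⟩
        Σℚ (λ s → t s * ⟪ vs s , x ⟫)  ≡⟨ Σ-cong (λ s → cong (t s *_) (⟪vs,x⟫≡1 s)) ⟩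
        Σℚ (λ s → t s * 1ℚ)            ≡⟨ Σ-cong (λ s → ℚP.*-identityʳ (t s)) ⟩
        Σℚ t                           ≡⟨ Σt≡1 ⟩
        1ℚ                             ∎
        where open ≡-Reasoning

      attains⇒hull : ∀ c → InPolar Q c → ⟪ c , x ⟫ ≡ 1ℚ → InConvHull Q vs c
      attains⇒hull c c∈polar ⟪c,x⟫≡1 = t , t≥0 , Σt≡1 , c≈
        where
        t : Fin k → ℚ
        t s = - ⟪ c , C s ⟫
        t≥0 : ∀ s → 0ℚ ≤ t s
        t≥0 s = ℚP.neg-antimono-≤ (⟪c,u⟫≤0 c c∈polar ⟪c,x⟫≡1 (C s) (C-ker s)
          (λ s' → subst (0ℚ ≤_) (sym (C-arr s s')) (𝕖-nonneg s s')))
        Σt≡1 : Σℚ t ≡ 1ℚ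
        Σt≡1 = begin
          Σℚ t                                    ≡⟨ Σ-cong (λ s → sym (-1* ⟪ c , C s ⟫)) ⟩
          Σℚ (λ s → - 1ℚ * ⟪ c , C s ⟫)           ≡⟨ Σ-cong (λ s → cong (_* ⟪ c , C s ⟫) (x-arr s)) ⟨
          Σℚ (λ s → x (arr s) * ⟪ c , C s ⟫)      ≡⟨ ⟪c,w⟫-expand c c∈polar ⟪c,x⟫≡1 x (flow−𝟏∈ker Q y-flow) ⟨
          ⟪ c , x ⟫                               ≡⟨ ⟪c,x⟫≡1 ⟩
          1ℚ                                      ∎
          where open ≡-Reasoning
        c≈ : Same Q c (lincomb t vs)
        c≈ w w∈ker = begin
          ⟪ c , w ⟫                               ≡⟨ ⟪c,w⟫-expand c c∈polar ⟪c,x⟫≡1 w w∈ker ⟩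
          Σℚ (λ s → w (arr s) * ⟪ c , C s ⟫)      ≡⟨ Σ-cong (λ s → swap-signs (w (arr s)) ⟪ c , C s ⟫) ⟩
          Σℚ (λ s → t s * - w (arr s))            ≡⟨ Σ-cong (λ s → cong (t s *_) (⟪vs,w⟫ s w w∈ker)) ⟨
          Σℚ (λ s → t s * ⟪ vs s , w ⟫)           ≡⟨ ⟪⟫-lincombˡ t vs w ⟨
          ⟪ lincomb t vs , w ⟫                    ∎
          where
          open ≡-Reasoning
          swap-signs : ∀ w p → w * p ≡ (- p) * (- w)
          swap-signs = solve 2 (λ w p → w :* p := (:- p) :* (:- w)) refl

  Neighborly-0 : ∀ Q → Neighborly Q 0
  Neighborly-0 Q vs _ _ =
    (λ c → ⊥-elim ∘ hull-empty {c}) , (λ _ → 0ℚ) , 1ℚ , ker-zero Q ,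
    (λ c _ → subst (_≤ 1ℚ) (sym (⟪⟫-zeroʳ c (λ _ → refl))) 0≤1) ,
    (λ c → ⊥-elim ∘ hull-empty {c}) ,
    (λ c _ ⟪c,0⟫≡1 → ⊥-elim (ℚP.1≢0 (trans (sym ⟪c,0⟫≡1) (⟪⟫-zeroʳ c (λ _ → refl)))))
    where
    hull-empty : ∀ {c} → InConvHull Q vs c → ⊥
    hull-empty (_ , _ , Σt≡1 , _) = ℚP.1≢0 (sym Σt≡1)

  -- The complete bipartite quiver

  ∃-not-in-image : ∀ {k n} (f : Fin k → Fin n) → k ℕ.< n → ∃ λ r → ∀ s → f s ≢ r
  ∃-not-in-image {k} {n} f k<n with ¬∀⟶∃¬ n (λ r → ∃ λ s → f s ≡ r) (λ r → any? (λ s → f s ≟ r)) not-onto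
    where
    not-onto : ¬ (∀ r → ∃ λ s → f s ≡ r)
    not-onto onto with pigeonhole k<n (proj₁ ∘ onto)
    ... | i , j , i<j , same-preimage =
      <⇒≢ i<j (trans (sym (proj₂ (onto i))) (trans (cong f same-preimage) (proj₂ (onto j))))
  ... | r , r∉image = r , λ s fs≡r → r∉image (s , fs≡r)

  module Bipartite (p q : ℕ) where

    row : Fin (p ℕ.* q) → Fin p
    row a = proj₁ (remQuot {p} q a)

    col : Fin (p ℕ.* q) → Fin q
    col a = proj₂ (remQuot {p} q a)

    row-combine : ∀ i j → row (combine i j) ≡ i
    row-combine i j = cong proj₁ (remQuot-combine {p} {q} i j)

    col-combine : ∀ i j → col (combine i j) ≡ j
    col-combine i j = cong proj₂ (remQuot-combine {p} {q} i j)

    row-col-injective : ∀ {a b} → row a ≡ row b → col a ≡ col b → a ≡ b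
    row-col-injective {a} {b} ra≡rb ca≡cb = begin
      a                          ≡⟨ combine-remQuot {p} q a ⟨
      combine (row a) (col a)    ≡⟨ cong₂ combine ra≡rb ca≡cb ⟩
      combine (row b) (col b)    ≡⟨ combine-remQuot {p} q b ⟩
      b                          ∎
      where open ≡-Reasoning

    𝕖-row-col : ∀ a b → 𝕖 a b ≡ 𝕖 (row a) (row b) * 𝕖 (col a) (col b)
    𝕖-row-col a b with a ≟ b
    ... | yes refl = sym (trans (cong₂ _*_ (𝕖-diag (row a)) (𝕖-diag (col a))) (ℚP.*-identityˡ 1ℚ))
    ... | no a≢b   = sym (product≡0 (row a ≟ row b))
      where
      product≡0 : Dec (row a ≡ row b) → 𝕖 (row a) (row b) * 𝕖 (col a) (col b) ≡ 0ℚ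
      product≡0 (no ra≢rb)  = trans (cong (_* 𝕖 (col a) (col b)) (𝕖-off ra≢rb)) (ℚP.*-zeroˡ (𝕖 (col a) (col b)))
      product≡0 (yes ra≡rb) = trans (cong (𝕖 (row a) (row b) *_) (𝕖-off (a≢b ∘ row-col-injective ra≡rb)))
                                    (ℚP.*-zeroʳ (𝕖 (row a) (row b)))

    onRight : Fin p ⊎ Fin q → ℚ
    onRight = [ (λ _ → 0ℚ) , (λ _ → 1ℚ) ]

    isRight : Vecℚ (p ℕ.+ q)
    isRight = onRight ∘ splitAt p

    -- Every arrow enters Q_R, so pairing inc x with the indicator of Q_R gives Σ x.
    Σ-ker : ∀ x → InKer (Qbip p q) x → Σℚ x ≡ 0ℚ
    Σ-ker x x∈ker = begin
      Σℚ x                                      ≡⟨ Σ-cong (λ a → ℚP.*-identityˡ (x a)) ⟨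
      ⟪ 𝟏 , x ⟫                                 ≡⟨ Σ-cong (λ a → cong (_* x a) arrow-crosses) ⟨
      ⟪ (λ a → isRight (head Qpq a) - isRight (tail Qpq a)) , x ⟫  ≡⟨ ⟪⟫-inc Qpq isRight x ⟨
      ⟪ isRight , inc Qpq x ⟫                   ≡⟨ ⟪⟫-zeroʳ isRight x∈ker ⟩
      0ℚ                                        ∎
      where
      open ≡-Reasoning
      Qpq = Qbip p q
      arrow-crosses : ∀ {a} → isRight (head Qpq a) - isRight (tail Qpq a) ≡ 1ℚ
      arrow-crosses {a} = cong₂ (λ h t → onRight h - onRight t) (splitAt-↑ʳ p q (col a)) (splitAt-↑ˡ p (row a) q)

    cycleAt : Fin p → Fin q → Fin p → Fin q → Fin p → Fin q → ℚ
    cycleAt i j i' j' u v = (𝕖 i u - 𝕖 i' u) * (𝕖 j v - 𝕖 j' v)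

    cycle : Fin p → Fin q → Fin p → Fin q → Vecℚ (p ℕ.* q)
    cycle i j i' j' a = cycleAt i j i' j' (row a) (col a)

    𝕖-combine : ∀ i j a → 𝕖 (combine i j) a ≡ 𝕖 i (row a) * 𝕖 j (col a)
    𝕖-combine i j a = trans (𝕖-row-col (combine i j) a)
      (cong₂ (λ i j → 𝕖 i (row a) * 𝕖 j (col a)) (row-combine i j) (col-combine i j))

    inc-𝕖-combine : ∀ i j v → inc (Qbip p q) (𝕖 (combine i j)) v ≡ 𝕖 (p ↑ʳ j) v - 𝕖 (i ↑ˡ q) v
    inc-𝕖-combine i j v = trans (inc-𝕖 (Qbip p q) (combine i j) v)
      (cong₂ (λ i j → 𝕖 (p ↑ʳ j) v - 𝕖 (i ↑ˡ q) v) (row-combine i j) (col-combine i j))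

    cycle-ker : ∀ i j i' j' → InKer (Qbip p q) (cycle i j i' j')
    cycle-ker i j i' j' v = begin
      inc Qpq (cycle i j i' j') v
        ≡⟨ inc-cong Qpq cycle-as-𝕖 v ⟩
      inc Qpq ((𝕖 (combine i j) −ᵥ 𝕖 (combine i j')) −ᵥ (𝕖 (combine i' j) −ᵥ 𝕖 (combine i' j'))) v
        ≡⟨ trans (inc-− Qpq _ _ v) (cong₂ _-_ (inc-− Qpq _ _ v) (inc-− Qpq _ _ v)) ⟩
      (inc Qpq (𝕖 (combine i j)) v - inc Qpq (𝕖 (combine i j')) v)
        - (inc Qpq (𝕖 (combine i' j)) v - inc Qpq (𝕖 (combine i' j')) v)
        ≡⟨ cong₂ _-_ (cong₂ _-_ (inc-𝕖-combine i j v) (inc-𝕖-combine i j' v))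
                     (cong₂ _-_ (inc-𝕖-combine i' j v) (inc-𝕖-combine i' j' v)) ⟩
      ((𝕖 (p ↑ʳ j) v - 𝕖 (i ↑ˡ q) v) - (𝕖 (p ↑ʳ j') v - 𝕖 (i ↑ˡ q) v))
        - ((𝕖 (p ↑ʳ j) v - 𝕖 (i' ↑ˡ q) v) - (𝕖 (p ↑ʳ j') v - 𝕖 (i' ↑ˡ q) v))
        ≡⟨ telescope (𝕖 (p ↑ʳ j) v) (𝕖 (p ↑ʳ j') v) (𝕖 (i ↑ˡ q) v) (𝕖 (i' ↑ˡ q) v) ⟩
      0ℚ  ∎
      where
      open ≡-Reasoning
      Qpq = Qbip p q
      four-terms : ∀ x x' y y' → (x - x') * (y - y') ≡ (x * y - x * y') - (x' * y - x' * y')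
      four-terms = solve 4 (λ x x' y y' → (x :- x') :* (y :- y') := (x :* y :- x :* y') :- (x' :* y :- x' :* y')) refl
      cycle-as-𝕖 : cycle i j i' j' ≗ (𝕖 (combine i j) −ᵥ 𝕖 (combine i j')) −ᵥ (𝕖 (combine i' j) −ᵥ 𝕖 (combine i' j'))
      cycle-as-𝕖 a = trans (four-terms (𝕖 i (row a)) (𝕖 i' (row a)) (𝕖 j (col a)) (𝕖 j' (col a)))
        (sym (cong₂ _-_ (cong₂ _-_ (𝕖-combine i j a) (𝕖-combine i j' a))
                        (cong₂ _-_ (𝕖-combine i' j a) (𝕖-combine i' j' a))))
      telescope : ∀ b b' a a' → ((b - a) - (b' - a)) - ((b - a') - (b' - a')) ≡ 0ℚ
      telescope = solve 4 (λ b b' a a' → ((b :- a) :- (b' :- a)) :- ((b :- a') :- (b' :- a')) := con 0ℚ) refl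

  module Margins (K A B : ℚ) (K≥0 : 0ℚ ≤ K) (A≥0 : 0ℚ ≤ A) (B≥0 : 0ℚ ≤ B) (1≤A+B : 1ℚ ≤ A + B) where

    P Q D : ℚ
    P = 1ℚ + (K + A)
    Q = 1ℚ + (K + B)
    D = 1ℚ + K * (K + A + B)

    -- P, Q, K stand for p = 1 + k + A, q = 1 + k + B and k. If y = 𝟏 + (K·M − (D + K)·S)/D with
    -- M a = (1 − P·[row a = r₀])(1 − Q·[col a = c₀]) then D·y a = margin [row a = r₀] [col a = c₀] (S a);
    -- D is chosen so that the margin is 0 on the chosen arrows and at least 1 everywhere else.
    margin : ℚ → ℚ → ℚ → ℚ
    margin x y σ = D + (K * ((1ℚ - P * x) * (1ℚ - Q * y)) - (D + K) * σ)

    private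
      1≤1+ : ∀ {t} → 0ℚ ≤ t → 1ℚ ≤ 1ℚ + t
      1≤1+ = p≤p+q

      K+A+B≥0 : 0ℚ ≤ K + A + B
      K+A+B≥0 = 0≤+ (0≤+ K≥0 A≥0) B≥0

      D' : ∀ {n} → Polynomial n → Polynomial n → Polynomial n → Polynomial n
      D' K A B = con 1ℚ :+ K :* (K :+ A :+ B)

      margin' : ∀ {n} → Polynomial n → Polynomial n → Polynomial n →
        Polynomial n → Polynomial n → Polynomial n → Polynomial n
      margin' K A B x y σ = D' K A B :+ (K :* ((con 1ℚ :- (con 1ℚ :+ (K :+ A)) :* x) :* (con 1ℚ :- (con 1ℚ :+ (K :+ B)) :* y))
                                       :- (D' K A B :+ K) :* σ)

      D+K≥0 : 0ℚ ≤ D + K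
      D+K≥0 = 0≤+ (0≤+ 0≤1 (0≤* K≥0 K+A+B≥0)) K≥0

    D≥1 : 1ℚ ≤ D
    D≥1 = 1≤1+ (0≤* K≥0 K+A+B≥0)

    margin-arrow : margin 0ℚ 0ℚ 1ℚ ≡ 0ℚ
    margin-arrow = solve 3 (λ K A B → margin' K A B (con 0ℚ) (con 0ℚ) (con 1ℚ) := con 0ℚ) refl K A B

    margin-off : 1ℚ ≤ margin 0ℚ 0ℚ 0ℚ
    margin-off = subst (1ℚ ≤_) (sym (solve 3 (λ K A B →
        margin' K A B (con 0ℚ) (con 0ℚ) (con 0ℚ) := con 1ℚ :+ K :* (K :+ A :+ B :+ con 1ℚ)) refl K A B))
      (1≤1+ (0≤* K≥0 (0≤+ K+A+B≥0 0≤1)))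

    margin-row : ∀ {T} → 0ℚ ≤ T → 1ℚ ≤ margin 1ℚ 0ℚ (- T)
    margin-row {T} T≥0 = subst (1ℚ ≤_) (sym (solve 4 (λ K A B T →
        margin' K A B (con 1ℚ) (con 0ℚ) (:- T) := con 1ℚ :+ (K :* B :+ (D' K A B :+ K) :* T)) refl K A B T))
      (1≤1+ (0≤+ (0≤* K≥0 B≥0) (0≤* D+K≥0 T≥0)))

    margin-col : ∀ {T} → 0ℚ ≤ T → 1ℚ ≤ margin 0ℚ 1ℚ (- T)
    margin-col {T} T≥0 = subst (1ℚ ≤_) (sym (solve 4 (λ K A B T →
        margin' K A B (con 0ℚ) (con 1ℚ) (:- T) := con 1ℚ :+ (K :* A :+ (D' K A B :+ K) :* T)) refl K A B T))
      (1≤1+ (0≤+ (0≤* K≥0 A≥0) (0≤* D+K≥0 T≥0)))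

    margin-corner : 1ℚ ≤ margin 1ℚ 1ℚ K
    margin-corner = subst (1ℚ ≤_) (sym (solve 3 (λ K A B →
        margin' K A B (con 1ℚ) (con 1ℚ) K := con 1ℚ :+ K :* (A :* B :+ (A :+ B :- con 1ℚ))) refl K A B))
      (1≤1+ (0≤* K≥0 (0≤+ (0≤* A≥0 B≥0) (≤⇒0≤- 1≤A+B))))

  module Construction {p q k : ℕ} (k<p : k ℕ.< p) (k<q : k ℕ.< q) (p≢q : p ≢ q)
    (arr : Fin k → Fin (p ℕ.* q)) (arr-injective : ∀ {s s'} → arr s ≡ arr s' → s ≡ s') where

    open Bipartite p q

    arr-row : Fin k → Fin p
    arr-row = row ∘ arr

    arr-col : Fin k → Fin q
    arr-col = col ∘ arr

    r₀ : Fin p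
    r₀ = proj₁ (∃-not-in-image arr-row k<p)

    c₀ : Fin q
    c₀ = proj₁ (∃-not-in-image arr-col k<q)

    arr-row≢r₀ : ∀ s → arr-row s ≢ r₀
    arr-row≢r₀ = proj₂ (∃-not-in-image arr-row k<p)

    arr-col≢c₀ : ∀ s → arr-col s ≢ c₀
    arr-col≢c₀ = proj₂ (∃-not-in-image arr-col k<q)

    dp dq : ℕ
    dp = proj₁ (ℕP.m≤n⇒∃[o]m+o≡n k<p)
    dq = proj₁ (ℕP.m≤n⇒∃[o]m+o≡n k<q)

    1+k+dp≡p : suc k ℕ.+ dp ≡ p
    1+k+dp≡p = proj₂ (ℕP.m≤n⇒∃[o]m+o≡n k<p)

    1+k+dq≡q : suc k ℕ.+ dq ≡ q
    1+k+dq≡q = proj₂ (ℕP.m≤n⇒∃[o]m+o≡n k<q)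

    dp+dq≢0 : dp ℕ.+ dq ≢ 0
    dp+dq≢0 dp+dq≡0 = p≢q (begin
      p               ≡⟨ 1+k+dp≡p ⟨
      suc k ℕ.+ dp     ≡⟨ cong (suc k ℕ.+_) (trans (ℕP.m+n≡0⇒m≡0 dp dp+dq≡0) (sym (ℕP.m+n≡0⇒n≡0 dp dp+dq≡0))) ⟩
      suc k ℕ.+ dq     ≡⟨ 1+k+dq≡q ⟩
      q               ∎)
      where open ≡-Reasoning

    K : ℚ
    K = fromℕ k

    open Margins K (fromℕ dp) (fromℕ dq) (fromℕ-nonneg k) (fromℕ-nonneg dp) (fromℕ-nonneg dq)
      (subst (1ℚ ≤_) (fromℕ-+ dp dq) (fromℕ-≥1 dp+dq≢0))

    fromℕ-p≡P : fromℕ p ≡ P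
    fromℕ-p≡P = trans (cong fromℕ (sym 1+k+dp≡p)) (cong (1ℚ +_) (fromℕ-+ k dp))

    fromℕ-q≡Q : fromℕ q ≡ Q
    fromℕ-q≡Q = trans (cong fromℕ (sym 1+k+dq≡q)) (cong (1ℚ +_) (fromℕ-+ k dq))

    C : Fin k → Vecℚ (p ℕ.* q)
    C s = cycle (arr-row s) (arr-col s) r₀ c₀

    C-arr : ∀ s s' → C s (arr s') ≡ 𝕖 s s'
    C-arr s s' = begin
      (𝕖 (arr-row s) (arr-row s') - 𝕖 r₀ (arr-row s')) * (𝕖 (arr-col s) (arr-col s') - 𝕖 c₀ (arr-col s'))
        ≡⟨ cong₂ _*_ (𝕖-diff-off (arr-row s) (arr-row≢r₀ s' ∘ sym)) (𝕖-diff-off (arr-col s) (arr-col≢c₀ s' ∘ sym)) ⟩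
      𝕖 (arr-row s) (arr-row s') * 𝕖 (arr-col s) (arr-col s')   ≡⟨ 𝕖-row-col (arr s) (arr s') ⟨
      𝕖 (arr s) (arr s')                  ≡⟨ 𝕖-injective arr-injective s s' ⟩
      𝕖 s s'                              ∎
      where open ≡-Reasoning

    C-ker : ∀ s → InKer (Qbip p q) (C s)
    C-ker s = cycle-ker (arr-row s) (arr-col s) r₀ c₀

    M : Vecℚ (p ℕ.* q)
    M a = Σℚ (λ i → Σℚ (λ j → cycle i j r₀ c₀ a))

    M-ker : InKer (Qbip p q) M
    M-ker = ker-Σ (Qbip p q) (λ i a → Σℚ (λ j → cycle i j r₀ c₀ a))
      (λ i → ker-Σ (Qbip p q) (λ j → cycle i j r₀ c₀) (λ j → cycle-ker i j r₀ c₀))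

    M-value : ∀ a → M a ≡ (1ℚ - P * 𝕖 r₀ (row a)) * (1ℚ - Q * 𝕖 c₀ (col a))
    M-value a = trans (Σ-product (λ i → 𝕖 i (row a) - 𝕖 r₀ (row a)) (λ j → 𝕖 j (col a) - 𝕖 c₀ (col a)))
      (cong₂ _*_ (trans (Σ-𝕖-diff (row a) r₀) (cong (λ P → 1ℚ - P * 𝕖 r₀ (row a)) fromℕ-p≡P))
                 (trans (Σ-𝕖-diff (col a) c₀) (cong (λ Q → 1ℚ - Q * 𝕖 c₀ (col a)) fromℕ-q≡Q)))

    S : Vecℚ (p ℕ.* q)
    S a = Σℚ (λ s → C s a)

    w : Vecℚ (p ℕ.* q)
    w = (K *ᵥ M) −ᵥ ((D + K) *ᵥ S)

    w-ker : InKer (Qbip p q) w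
    w-ker = ker-− (Qbip p q) (ker-* (Qbip p q) K M-ker)
      (ker-* (Qbip p q) (D + K) (ker-Σ (Qbip p q) C C-ker))

    instance
      D>0 : ℚ.Positive D
      D>0 = ℚ.positive (ℚP.<-≤-trans (ℚP.positive⁻¹ 1ℚ) D≥1)
      D≢0 : ℚ.NonZero D
      D≢0 = ℚP.pos⇒nonZero D

    δ₀ : ℚ
    δ₀ = 1/ D

    δ₀>0 : 0ℚ < δ₀
    δ₀>0 = ℚP.positive⁻¹ δ₀ {{ℚP.1/pos⇒pos D}}

    y : Vecℚ (p ℕ.* q)
    y = 𝟏 +ᵥ δ₀ *ᵥ w

    y-flow : IsFlow (Qbip p q) y
    y-flow = flow-+ker (Qbip p q) (λ _ → refl) (ker-* (Qbip p q) δ₀ w-ker)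

    y≡δ₀*margin : ∀ a → y a ≡ δ₀ * margin (𝕖 r₀ (row a)) (𝕖 c₀ (col a)) (S a)
    y≡δ₀*margin a = sym (trans (cong (λ μ → δ₀ * (D + (K * μ - (D + K) * S a))) (sym (M-value a)))
                               (1/-*-+ D (w a)))

    margin-cong : ∀ {x x' y y' σ σ'} → x ≡ x' → y ≡ y' → σ ≡ σ' → margin x y σ ≡ margin x' y' σ'
    margin-cong refl refl refl = refl

    y-arr : ∀ s → y (arr s) ≡ 0ℚ
    y-arr s = begin
      y (arr s)                                                    ≡⟨ y≡δ₀*margin (arr s) ⟩
      δ₀ * margin (𝕖 r₀ (arr-row s)) (𝕖 c₀ (arr-col s)) (S (arr s))  ≡⟨ cong (δ₀ *_) (margin-cong
                                                                         (𝕖-off (arr-row≢r₀ s ∘ sym)) (𝕖-off (arr-col≢c₀ s ∘ sym)) S-arr) ⟩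
      δ₀ * margin 0ℚ 0ℚ 1ℚ                                         ≡⟨ cong (δ₀ *_) margin-arrow ⟩
      δ₀ * 0ℚ                                                      ≡⟨ ℚP.*-zeroʳ δ₀ ⟩
      0ℚ                                                           ∎
      where
      open ≡-Reasoning
      S-arr : S (arr s) ≡ 1ℚ
      S-arr = trans (Σ-cong (λ s' → C-arr s' s)) (Σ-𝕖 s)

    σ : Fin p → Fin q → ℚ
    σ u v = Σℚ (λ s → cycleAt (arr-row s) (arr-col s) r₀ c₀ u v)

    grid-margin : ∀ u v → (∃ λ s → arr-row s ≡ u × arr-col s ≡ v) ⊎ 1ℚ ≤ margin (𝕖 r₀ u) (𝕖 c₀ v) (σ u v)
    grid-margin u v with u ≟ r₀ | v ≟ c₀
    ... | yes refl | yes refl =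
      inj₂ (subst (1ℚ ≤_) (sym (margin-cong (𝕖-diag r₀) (𝕖-diag c₀) σ-corner)) margin-corner)
      where
      σ-corner : σ r₀ c₀ ≡ K
      σ-corner = trans (Σ-cong (λ s → cong₂ _*_ (𝕖-diff-diag (arr-row≢r₀ s)) (𝕖-diff-diag (arr-col≢c₀ s))))
                       (trans (Σ-const k 1ℚ) (ℚP.*-identityʳ K))
    ... | yes refl | no v≢c₀ =
      inj₂ (subst (1ℚ ≤_) (sym (margin-cong (𝕖-diag r₀) (𝕖-off (v≢c₀ ∘ sym)) σ-row))
                  (margin-row (Σ-nonneg (λ s → 𝕖-nonneg (arr-col s) v))))
      where
      σ-row : σ r₀ v ≡ - Σℚ (λ s → 𝕖 (arr-col s) v)
      σ-row = trans (Σ-cong (λ s → trans (cong₂ _*_ (𝕖-diff-diag (arr-row≢r₀ s)) (𝕖-diff-off (arr-col s) (v≢c₀ ∘ sym)))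
                                          (-1* (𝕖 (arr-col s) v))))
                    (Σ-distrib-neg (λ s → 𝕖 (arr-col s) v))
    ... | no u≢r₀ | yes refl =
      inj₂ (subst (1ℚ ≤_) (sym (margin-cong (𝕖-off (u≢r₀ ∘ sym)) (𝕖-diag c₀) σ-col))
                  (margin-col (Σ-nonneg (λ s → 𝕖-nonneg (arr-row s) u))))
      where
      σ-col : σ u c₀ ≡ - Σℚ (λ s → 𝕖 (arr-row s) u)
      σ-col = trans (Σ-cong (λ s → trans (cong₂ _*_ (𝕖-diff-off (arr-row s) (u≢r₀ ∘ sym)) (𝕖-diff-diag (arr-col≢c₀ s)))
                                          (trans (ℚP.*-comm (𝕖 (arr-row s) u) (- 1ℚ)) (-1* (𝕖 (arr-row s) u)))))
                    (Σ-distrib-neg (λ s → 𝕖 (arr-row s) u))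
    ... | no u≢r₀ | no v≢c₀ with any? (λ s → (arr-row s ≟ u) ×-dec (arr-col s ≟ v))
    ...   | yes hit = inj₁ hit
    ...   | no miss =
      inj₂ (subst (1ℚ ≤_) (sym (margin-cong (𝕖-off (u≢r₀ ∘ sym)) (𝕖-off (v≢c₀ ∘ sym)) σ-off)) margin-off)
      where
      term≡0 : ∀ s → 𝕖 (arr-row s) u * 𝕖 (arr-col s) v ≡ 0ℚ
      term≡0 s with arr-row s ≟ u
      ... | no _      = ℚP.*-zeroˡ (𝕖 (arr-col s) v)
      ... | yes row≡u = trans (ℚP.*-identityˡ (𝕖 (arr-col s) v)) (𝕖-off (λ col≡v → miss (s , row≡u , col≡v)))
      σ-off : σ u v ≡ 0ℚ
      σ-off = trans (Σ-cong (λ s → trans (cong₂ _*_ (𝕖-diff-off (arr-row s) (u≢r₀ ∘ sym)) (𝕖-diff-off (arr-col s) (v≢c₀ ∘ sym)))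
                                          (term≡0 s)))
                    (Σ-zero k)

    y-off : ∀ a → (∃ λ s → arr s ≡ a) ⊎ δ₀ ≤ y a
    y-off a with grid-margin (row a) (col a)
    ... | inj₁ (s , row≡ , col≡) = inj₁ (s , row-col-injective row≡ col≡)
    ... | inj₂ 1≤margin = inj₂ (begin
      δ₀                                                   ≡⟨ ℚP.*-identityʳ δ₀ ⟨
      δ₀ * 1ℚ                                              ≤⟨ ℚP.*-monoˡ-≤-nonNeg δ₀ {{ℚP.pos⇒nonNeg δ₀ {{ℚP.1/pos⇒pos D}}}} 1≤margin ⟩
      δ₀ * margin (𝕖 r₀ (row a)) (𝕖 c₀ (col a)) (S a)      ≡⟨ y≡δ₀*margin a ⟨
      y a                                                  ∎)
      where open ℚP.≤-Reasoning

  bipartite-neighborly : ∀ {p q k} → p ≢ q → k ℕ.< p → k ℕ.< q → Neighborly (Qbip p q) k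
  bipartite-neighborly {suc p'} {suc q'} {k} p≢q k<p k<q vs vs-vertex vs-distinct =
    FaceCriterion.hull-is-face Qpq arr y y-flow y-arr δ₀>0 y-off C C-ker C-arr vs (proj₂ ∘ vertex-arrow)
    where
    Qpq = Qbip (suc p') (suc q')

    vertex-arrow : ∀ s → ∃ λ a → Same Qpq (vs s) (−𝕖 a)
    vertex-arrow s = vertex⇒−𝕖 Qpq (Bipartite.Σ-ker (suc p') (suc q')) zero (vs s) (vs-vertex s)

    arr : Fin k → Fin (nA Qpq)
    arr = proj₁ ∘ vertex-arrow

    arr-injective : ∀ {s s'} → arr s ≡ arr s' → s ≡ s'
    arr-injective {s} {s'} arr-s≡arr-s' = vs-distinct s s'
      (Same-trans Qpq {vs s} {−𝕖 (arr s)} {vs s'} (proj₂ (vertex-arrow s))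
        (subst (λ a → Same Qpq (−𝕖 a) (vs s')) (sym arr-s≡arr-s')
          (Same-sym Qpq {vs s'} {−𝕖 (arr s')} (proj₂ (vertex-arrow s')))))

    open Construction k<p k<q p≢q arr arr-injective

open Neighborliness using (Neighborly-0; bipartite-neighborly)
open import Data.Nat as ℕ using (ℕ; zero; suc; _≤_; _⊓_; _∸_)
import Data.Nat.Properties as ℕP
open import Data.Nat.Coprimality using (Coprime)
open import Data.Nat.Divisibility using (_∣_; ∣-refl)
open import Data.Product using (_,_)
open import Relation.Nullary using (contradiction)
open import Relation.Binary.PropositionalEquality using (_≢_; subst)

lemma3p13 : (p q : ℕ) → 1 ≤ p → 1 ≤ q → Coprime p q →
    Neighborly (Qbip p q) ((p ⊓ q) ∸ 1)
lemma3p13 zero           _              ()  _  _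
lemma3p13 (suc _)        zero           _   () _
lemma3p13 (suc zero)     (suc q')       _   _  _       = Neighborly-0 (Qbip 1 (suc q'))
lemma3p13 (suc (suc p')) (suc zero)     _   _  _       = Neighborly-0 (Qbip (2 ℕ.+ p') 1)
lemma3p13 (suc (suc p')) (suc (suc q')) _   _  coprime =
  bipartite-neighborly p≢q (ℕ.s≤s (ℕP.m⊓n≤m (suc p') (suc q'))) (ℕ.s≤s (ℕP.m⊓n≤n (suc p') (suc q')))
  where
  p≢q : 2 ℕ.+ p' ≢ 2 ℕ.+ q'
  p≢q p≡q = contradiction (coprime (∣-refl , subst (2 ℕ.+ p' ∣_) p≡q ∣-refl)) λ ()
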